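{- If $\langle A;\wedge,\vee,^{\perp},0,1,\exists\rangle$ is a quantum monadic algebra and $p_s(x,y)=x^{\perp}\vee(x\wedge y)$, then $\langle A;p_s,0,\exists\rangle$ is a monadic quasi-implication algebra.
   Context: An ortholattice is a bounded lattice $\langle A;\wedge,\vee,0,1\rangle$ with a unary operation $^{\perp}$ such that $x\wedge x^{\perp}=0$, $x\vee x^{\perp}=1$, $x\le y\Rightarrow y^{\perp}\le x^{\perp}$, and $x^{\perp\perp}=x$. An orthomodular lattice is an ortholattice satisfying: $x\le y$ implies $y=x\vee(x^{\perp}\wedge y)$. A quantum monadic algebra is an orthomodular lattice with a unary operation $\exists$ satisfying for all $x,y$: $\exists 0=0$; $x\le\exists x$; $\exists(x\vee y)=\exists x\vee\exists y$; $\exists\exists x=\exists x$; $\exists((\exists x)^{\perp})=(\exists x)^{\perp}$. A quasi-implication algebra is a magma $\langle A;\cdot\rangle$ satisfying, for all $x,y,z$: (1) $(x\cdot y)\cdot x=x$; (2) $(x\cdot y)\cdot(x\cdot z)=(y\cdot x)\cdot(y\cdot z)$; (3) $((x\cdot y)\cdot(y\cdot x))\cdot x=((y\cdot x)\cdot(x\cdot y))\cdot y$. In any quasi-implication algebra $x\cdot x=y\cdot y$ for all $x,y$, and $1$ denotes this common element. A bounded quasi-implication algebra is a quasi-implication algebra with a distinguished element $0$ such that $0\cdot x=1$ for all $x$. A monadic quasi-implication algebra is an algebra $\langle A;\cdot,0,\Diamond\rangle$ such that $\langle A;\cdot,0\rangle$ is a bounded quasi-implication algebra and $\Diamond\colon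 A\to A$ satisfies, for all $x,y$: (a) $\Diamond\Diamond x\cdot\Diamond x=1$ and $x\cdot\Diamond x=1$; (b) $\Diamond(\Diamond x\cdot 0)=\Diamond x\cdot 0$ and $\Diamond 0=0$; (c) $\Diamond(((x\cdot 0)\cdot(y\cdot 0))\cdot x)=((\Diamond x\cdot 0)\cdot(\Diamond y\cdot 0))\cdot\Diamond x$. -}

module Defs where

open import Level using (Level; suc; _⊔_)
open import Relation.Binary.PropositionalEquality using (_≡_)
open import Algebra.Lattice.Structures using (IsLattice)

record IsOrthomodularLattice {a} {A : Set a}
    (_∧_ _∨_ : A → A → A) (_⊥ : A → A) (𝟘 𝟙 : A) : Set a where
  infix 4 _≤_
  _≤_ : A → A → Set a
  x ≤ y = x ∧ y ≡ x
  field
    isLattice     : IsLattice _≡_ _∨_ _∧_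
    𝟘-least       : ∀ x → 𝟘 ≤ x
    𝟙-greatest    : ∀ x → x ≤ 𝟙
    ∧-compl       : ∀ x → x ∧ (x ⊥) ≡ 𝟘
    ∨-compl       : ∀ x → x ∨ (x ⊥) ≡ 𝟙
    ⊥-antitone    : ∀ x y → x ≤ y → y ⊥ ≤ x ⊥
    ⊥-involutive  : ∀ x → (x ⊥) ⊥ ≡ x
    orthomodular  : ∀ x y → x ≤ y → y ≡ x ∨ ((x ⊥) ∧ y)

record IsQuantumMonadicAlgebra {a} {A : Set a}
    (_∧_ _∨_ : A → A → A) (_⊥ : A → A) (𝟘 𝟙 : A) (∃ : A → A) : Set a where
  field
    isOrthomodularLattice : IsOrthomodularLattice _∧_ _∨_ _⊥ 𝟘 𝟙
  open IsOrthomodularLattice isOrthomodularLattice public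
  field
    ∃-𝟘       : ∃ 𝟘 ≡ 𝟘
    ∃-incr    : ∀ x → x ≤ ∃ x
    ∃-∨       : ∀ x y → ∃ (x ∨ y) ≡ ∃ x ∨ ∃ y
    ∃-idem    : ∀ x → ∃ (∃ x) ≡ ∃ x
    ∃-⊥       : ∀ x → ∃ ((∃ x) ⊥) ≡ (∃ x) ⊥

record IsQuasiImplicationAlgebra {a} {A : Set a} (_·_ : A → A → A) : Set a where
  field
    qi-1 : ∀ x y → (x · y) · x ≡ x
    qi-2 : ∀ x y z → (x · y) · (x · z) ≡ (y · x) · (y · z)
    qi-3 : ∀ x y → ((x · y) · (y · x)) · x ≡ ((y · x) · (x · y)) · y

-- Bounded quasi-implication algebra: 0 · x = 1 for all x, where 1 = x · x
-- (the common value); we write 1 as 0 · 0.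
record IsBoundedQuasiImplicationAlgebra {a} {A : Set a}
    (_·_ : A → A → A) (𝟘 : A) : Set a where
  field
    isQuasiImplicationAlgebra : IsQuasiImplicationAlgebra _·_
  open IsQuasiImplicationAlgebra isQuasiImplicationAlgebra public
  𝟙 : A
  𝟙 = 𝟘 · 𝟘
  field
    𝟘-bottom : ∀ x → 𝟘 · x ≡ 𝟙

record IsMonadicQuasiImplicationAlgebra {a} {A : Set a}
    (_·_ : A → A → A) (𝟘 : A) (◇ : A → A) : Set a where
  field
    isBoundedQuasiImplicationAlgebra : IsBoundedQuasiImplicationAlgebra _·_ 𝟘
  open IsBoundedQuasiImplicationAlgebra isBoundedQuasiImplicationAlgebra public
  field
    ◇-a₁ : ∀ x → ◇ (◇ x) · ◇ x ≡ 𝟙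
    ◇-a₂ : ∀ x → x · ◇ x ≡ 𝟙
    ◇-b₁ : ∀ x → ◇ (◇ x · 𝟘) ≡ ◇ x · 𝟘
    ◇-b₂ : ◇ 𝟘 ≡ 𝟘
    ◇-c  : ∀ x y → ◇ (((x · 𝟘) · (y · 𝟘)) · x)
                   ≡ ((◇ x · 𝟘) · (◇ y · 𝟘)) · ◇ x

p-s : ∀ {a} {A : Set a} (_∧_ _∨_ : A → A → A) (_⊥ : A → A) → A → A → A
p-s _∧_ _∨_ _⊥ x y = (x ⊥) ∨ (x ∧ y)

-- In an orthomodular lattice the Sasaki arrow x · y = x⊥ ∨ (x ∧ y) satisfies
-- x ∧ (x · y) = x ∧ y and (x · y)⊥ ∨ x⊥ = (x ∧ y)⊥.  With the orthomodular law these
-- give the normal forms (x · y) · (x · z) = (x ∧ y) · z and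
-- ((x · y) · (y · x)) · x = ((x · y) ∧ (y · x))⊥ ∨ (x ∧ y), from which the
-- quasi-implication axioms follow by commutativity of ∧.  Since x · 0 = x⊥ and
-- ((x · 0) · (y · 0)) · x = x ∨ y, the monadic axioms are the quantifier axioms of ∃
-- read through these identities.
module Submission where

open import Defs
open import Relation.Binary.PropositionalEquality
open import Algebra.Bundles using (CommutativeSemigroup)
import Algebra.Structures as Structures
open import Algebra.Lattice.Bundles using (Lattice)
open import Algebra.Lattice.Structures using (IsLattice)
import Algebra.Lattice.Properties.Lattice as LatticeProperties
import Algebra.Properties.CommutativeSemigroup as CommutativeSemigroupProperties
import Relation.Binary.Lattice as Order

module OrthomodularLatticeProperties
  {a} {A : Set a} {_∧_ _∨_ : A → A → A} {_⊥ : A → A} {𝟘 𝟙 : A}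
  (O : IsOrthomodularLattice _∧_ _∨_ _⊥ 𝟘 𝟙) where

  open IsOrthomodularLattice O public
  open IsLattice isLattice public using (∨-comm; ∨-assoc; ∧-comm; ∧-assoc)
  open ≡-Reasoning

  lattice : Lattice a a
  lattice = record { isLattice = isLattice }

  open LatticeProperties lattice using (∧-idem; ∧-isSemilattice; ∨-∧-orderTheoreticLattice)

  ∧-commutativeSemigroup : CommutativeSemigroup a a
  ∧-commutativeSemigroup = record
    { isCommutativeSemigroup = Structures.IsCommutativeBand.isCommutativeSemigroup ∧-isSemilattice }

  open CommutativeSemigroupProperties ∧-commutativeSemigroup using (interchange)

  -- The library orders a lattice by x ≡ x ∧ y, the symmetric form of the order used here.
  private module ⊑ = Order.Lattice ∨-∧-orderTheoreticLattice

  ≤-refl : ∀ x → x ≤ x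
  ≤-refl = ∧-idem

  ≤-reflexive : ∀ {x y} → x ≡ y → x ≤ y
  ≤-reflexive {x} refl = ≤-refl x

  ≤-trans : ∀ {x y z} → x ≤ y → y ≤ z → x ≤ z
  ≤-trans p q = sym (⊑.trans (sym p) (sym q))

  ≤-antisym : ∀ {x y} → x ≤ y → y ≤ x → x ≡ y
  ≤-antisym p q = ⊑.antisym (sym p) (sym q)

  x∧y≤x : ∀ x y → x ∧ y ≤ x
  x∧y≤x x y = sym (⊑.x∧y≤x x y)

  x∧y≤y : ∀ x y → x ∧ y ≤ y
  x∧y≤y x y = sym (⊑.x∧y≤y x y)

  ∧-greatest : ∀ {x y z} → x ≤ y → x ≤ z → x ≤ y ∧ z
  ∧-greatest p q = sym (⊑.∧-greatest (sym p) (sym q))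

  x≤x∨y : ∀ x y → x ≤ x ∨ y
  x≤x∨y x y = sym (⊑.x≤x∨y x y)

  y≤x∨y : ∀ x y → y ≤ x ∨ y
  y≤x∨y x y = sym (⊑.y≤x∨y x y)

  ∨-least : ∀ {x y z} → x ≤ z → y ≤ z → x ∨ y ≤ z
  ∨-least p q = sym (⊑.∨-least (sym p) (sym q))

  ∧-distribˡ-∧ : ∀ x y z → x ∧ (y ∧ z) ≡ (x ∧ y) ∧ (x ∧ z)
  ∧-distribˡ-∧ x y z = begin
    x ∧ (y ∧ z)       ≡⟨ cong (_∧ (y ∧ z)) (∧-idem x) ⟨
    (x ∧ x) ∧ (y ∧ z) ≡⟨ interchange x x y z ⟩
    (x ∧ y) ∧ (x ∧ z) ∎

  ∨-identityʳ : ∀ x → x ∨ 𝟘 ≡ x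
  ∨-identityʳ x = ≤-antisym (∨-least (≤-refl x) (𝟘-least x)) (x≤x∨y x 𝟘)

  ∧-zeroʳ : ∀ x → x ∧ 𝟘 ≡ 𝟘
  ∧-zeroʳ x = trans (∧-comm x 𝟘) (𝟘-least x)

  ⊥-antitone′ : ∀ {x y} → x ≤ y ⊥ → y ≤ x ⊥
  ⊥-antitone′ {x} {y} p = subst (_≤ x ⊥) (⊥-involutive y) (⊥-antitone x (y ⊥) p)

  deMorgan₂ : ∀ x y → (x ∨ y) ⊥ ≡ (x ⊥) ∧ (y ⊥)
  deMorgan₂ x y = ≤-antisym
    (∧-greatest (⊥-antitone _ _ (x≤x∨y x y)) (⊥-antitone _ _ (y≤x∨y x y)))
    (⊥-antitone′ (∨-least (⊥-antitone′ (x∧y≤x (x ⊥) (y ⊥))) (⊥-antitone′ (x∧y≤y (x ⊥) (y ⊥)))))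

  deMorgan₁ : ∀ x y → (x ∧ y) ⊥ ≡ (x ⊥) ∨ (y ⊥)
  deMorgan₁ x y = begin
    (x ∧ y) ⊥                 ≡⟨ cong _⊥ (cong₂ _∧_ (⊥-involutive x) (⊥-involutive y)) ⟨
    (((x ⊥) ⊥) ∧ ((y ⊥) ⊥)) ⊥ ≡⟨ cong _⊥ (deMorgan₂ (x ⊥) (y ⊥)) ⟨
    (((x ⊥) ∨ (y ⊥)) ⊥) ⊥     ≡⟨ ⊥-involutive _ ⟩
    (x ⊥) ∨ (y ⊥)             ∎

  orthomodular-⊥ : ∀ {x y} → x ⊥ ≤ y → y ≡ (x ⊥) ∨ (x ∧ y)
  orthomodular-⊥ {x} {y} p =
    trans (orthomodular (x ⊥) y p) (cong (λ t → (x ⊥) ∨ (t ∧ y)) (⊥-involutive x))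

  orthomodular-dual : ∀ {x y} → y ≤ x → x ∧ ((x ⊥) ∨ y) ≡ y
  orthomodular-dual {x} {y} p = sym (begin
    y                                ≡⟨ ⊥-involutive y ⟨
    (y ⊥) ⊥                          ≡⟨ cong _⊥ (orthomodular-⊥ (⊥-antitone y x p)) ⟩
    ((x ⊥) ∨ (x ∧ (y ⊥))) ⊥          ≡⟨ deMorgan₂ _ _ ⟩
    ((x ⊥) ⊥) ∧ ((x ∧ (y ⊥)) ⊥)      ≡⟨ cong₂ _∧_ (⊥-involutive x) (deMorgan₁ x (y ⊥)) ⟩
    x ∧ ((x ⊥) ∨ ((y ⊥) ⊥))          ≡⟨ cong (λ t → x ∧ ((x ⊥) ∨ t)) (⊥-involutive y) ⟩
    x ∧ ((x ⊥) ∨ y)                  ∎)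

module SasakiImplication
  {a} {A : Set a} {_∧_ _∨_ : A → A → A} {_⊥ : A → A} {𝟘 𝟙 : A}
  (O : IsOrthomodularLattice _∧_ _∨_ _⊥ 𝟘 𝟙) where

  open OrthomodularLatticeProperties O
  open ≡-Reasoning

  _·_ : A → A → A
  _·_ = p-s _∧_ _∨_ _⊥

  x≤y⇒x·y≡𝟙 : ∀ {x y} → x ≤ y → x · y ≡ 𝟙
  x≤y⇒x·y≡𝟙 {x} {y} p = trans (cong ((x ⊥) ∨_) p) (trans (∨-comm (x ⊥) x) (∨-compl x))

  x·𝟘≡x⊥ : ∀ x → x · 𝟘 ≡ x ⊥
  x·𝟘≡x⊥ x = trans (cong ((x ⊥) ∨_) (∧-zeroʳ x)) (∨-identityʳ (x ⊥))

  y≤x⇒x·y≡x⊥∨y : ∀ {x y} → y ≤ x → x · y ≡ (x ⊥) ∨ y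
  y≤x⇒x·y≡x⊥∨y {x} {y} p = cong ((x ⊥) ∨_) (trans (∧-comm x y) p)

  x⊥≤x·y : ∀ x y → x ⊥ ≤ x · y
  x⊥≤x·y x y = x≤x∨y (x ⊥) (x ∧ y)

  x∧y≤x·y : ∀ x y → x ∧ y ≤ x · y
  x∧y≤x·y x y = y≤x∨y (x ⊥) (x ∧ y)

  x∧[x·y]≡x∧y : ∀ x y → x ∧ (x · y) ≡ x ∧ y
  x∧[x·y]≡x∧y x y = orthomodular-dual (x∧y≤x x y)

  [x·y]⊥≡x∧[x∧y]⊥ : ∀ x y → (x · y) ⊥ ≡ x ∧ ((x ∧ y) ⊥)
  [x·y]⊥≡x∧[x∧y]⊥ x y = trans (deMorgan₂ (x ⊥) (x ∧ y)) (cong (_∧ ((x ∧ y) ⊥)) (⊥-involutive x))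

  x≡[x·y]⊥∨[x∧y] : ∀ x y → x ≡ ((x · y) ⊥) ∨ (x ∧ y)
  x≡[x·y]⊥∨[x∧y] x y = begin
    x                                  ≡⟨ orthomodular (x ∧ y) x (x∧y≤x x y) ⟩
    (x ∧ y) ∨ (((x ∧ y) ⊥) ∧ x)        ≡⟨ ∨-comm _ _ ⟩
    (((x ∧ y) ⊥) ∧ x) ∨ (x ∧ y)        ≡⟨ cong (_∨ (x ∧ y)) (∧-comm _ x) ⟩
    (x ∧ ((x ∧ y) ⊥)) ∨ (x ∧ y)        ≡⟨ cong (_∨ (x ∧ y)) ([x·y]⊥≡x∧[x∧y]⊥ x y) ⟨
    ((x · y) ⊥) ∨ (x ∧ y)              ∎

  [x·y]⊥∨x⊥≡[x∧y]⊥ : ∀ x y → ((x · y) ⊥) ∨ (x ⊥) ≡ (x ∧ y) ⊥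
  [x·y]⊥∨x⊥≡[x∧y]⊥ x y = begin
    ((x · y) ⊥) ∨ (x ⊥)                ≡⟨ ∨-comm _ _ ⟩
    (x ⊥) ∨ ((x · y) ⊥)                ≡⟨ cong ((x ⊥) ∨_) ([x·y]⊥≡x∧[x∧y]⊥ x y) ⟩
    (x ⊥) ∨ (x ∧ ((x ∧ y) ⊥))          ≡⟨ orthomodular-⊥ (⊥-antitone _ _ (x∧y≤x x y)) ⟨
    (x ∧ y) ⊥                          ∎

  [x·y]∧[x·z]≡x·[y∧z] : ∀ x y z → (x · y) ∧ (x · z) ≡ x · (y ∧ z)
  [x·y]∧[x·z]≡x·[y∧z] x y z = begin
    m                                  ≡⟨ orthomodular-⊥ (∧-greatest (x⊥≤x·y x y) (x⊥≤x·y x z)) ⟩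
    (x ⊥) ∨ (x ∧ m)                    ≡⟨ cong ((x ⊥) ∨_) x∧m≡x∧[y∧z] ⟩
    x · (y ∧ z)                        ∎
    where
    m = (x · y) ∧ (x · z)
    x∧m≡x∧[y∧z] : x ∧ m ≡ x ∧ (y ∧ z)
    x∧m≡x∧[y∧z] = begin
      x ∧ m                            ≡⟨ ∧-distribˡ-∧ x (x · y) (x · z) ⟩
      (x ∧ (x · y)) ∧ (x ∧ (x · z))    ≡⟨ cong₂ _∧_ (x∧[x·y]≡x∧y x y) (x∧[x·y]≡x∧y x z) ⟩
      (x ∧ y) ∧ (x ∧ z)                ≡⟨ ∧-distribˡ-∧ x y z ⟨
      x ∧ (y ∧ z)                      ∎

  [x·y]·[x·z]≡[x∧y]·z : ∀ x y z → (x · y) · (x · z) ≡ (x ∧ y) · z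
  [x·y]·[x·z]≡[x∧y]·z x y z = begin
    ((x · y) ⊥) ∨ ((x · y) ∧ (x · z))        ≡⟨ cong (((x · y) ⊥) ∨_) ([x·y]∧[x·z]≡x·[y∧z] x y z) ⟩
    ((x · y) ⊥) ∨ ((x ⊥) ∨ (x ∧ (y ∧ z)))    ≡⟨ ∨-assoc _ _ _ ⟨
    (((x · y) ⊥) ∨ (x ⊥)) ∨ (x ∧ (y ∧ z))    ≡⟨ cong₂ _∨_ ([x·y]⊥∨x⊥≡[x∧y]⊥ x y) (sym (∧-assoc x y z)) ⟩
    ((x ∧ y) ⊥) ∨ ((x ∧ y) ∧ z)              ∎

  [x·y]·x⊥≡[x∧y]⊥ : ∀ x y → (x · y) · (x ⊥) ≡ (x ∧ y) ⊥
  [x·y]·x⊥≡[x∧y]⊥ x y = trans (y≤x⇒x·y≡x⊥∨y (x⊥≤x·y x y)) ([x·y]⊥∨x⊥≡[x∧y]⊥ x y)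

  [[x·y]·[y·x]]·x≡[[x·y]∧[y·x]]⊥∨[x∧y] :
    ∀ x y → ((x · y) · (y · x)) · x ≡ (((x · y) ∧ (y · x)) ⊥) ∨ (x ∧ y)
  [[x·y]·[y·x]]·x≡[[x·y]∧[y·x]]⊥∨[x∧y] x y = begin
    w · x                              ≡⟨ y≤x⇒x·y≡x⊥∨y x≤w ⟩
    (w ⊥) ∨ x                          ≡⟨ cong ((w ⊥) ∨_) (x≡[x·y]⊥∨[x∧y] x y) ⟩
    (w ⊥) ∨ ((u ⊥) ∨ (x ∧ y))          ≡⟨ ∨-assoc _ _ _ ⟨
    ((w ⊥) ∨ (u ⊥)) ∨ (x ∧ y)          ≡⟨ cong (_∨ (x ∧ y)) ([x·y]⊥∨x⊥≡[x∧y]⊥ u v) ⟩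
    ((u ∧ v) ⊥) ∨ (x ∧ y)              ∎
    where
    u = x · y
    v = y · x
    w = u · v
    x∧y≤u∧v : x ∧ y ≤ u ∧ v
    x∧y≤u∧v = ∧-greatest (x∧y≤x·y x y) (≤-trans (≤-reflexive (∧-comm x y)) (x∧y≤x·y y x))
    x≤w : x ≤ w
    x≤w = subst (_≤ w) (sym (x≡[x·y]⊥∨[x∧y] x y))
      (∨-least (x⊥≤x·y u v) (≤-trans x∧y≤u∧v (x∧y≤x·y u v)))

  [[x·𝟘]·[y·𝟘]]·x≡x∨y : ∀ x y → ((x · 𝟘) · (y · 𝟘)) · x ≡ x ∨ y
  [[x·𝟘]·[y·𝟘]]·x≡x∨y x y = begin
    ((x · 𝟘) · (y · 𝟘)) · x            ≡⟨ cong₂ (λ s t → (s · t) · x) (x·𝟘≡x⊥ x) (x·𝟘≡x⊥ y) ⟩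
    ((x ⊥) · (y ⊥)) · x                ≡⟨ cong (((x ⊥) · (y ⊥)) ·_) (⊥-involutive x) ⟨
    ((x ⊥) · (y ⊥)) · ((x ⊥) ⊥)        ≡⟨ [x·y]·x⊥≡[x∧y]⊥ (x ⊥) (y ⊥) ⟩
    ((x ⊥) ∧ (y ⊥)) ⊥                  ≡⟨ cong _⊥ (deMorgan₂ x y) ⟨
    ((x ∨ y) ⊥) ⊥                      ≡⟨ ⊥-involutive (x ∨ y) ⟩
    x ∨ y                              ∎

  isQuasiImplicationAlgebra : IsQuasiImplicationAlgebra _·_
  isQuasiImplicationAlgebra = record
    { qi-1 = λ x y → begin
        ((x · y) ⊥) ∨ ((x · y) ∧ x)    ≡⟨ cong (((x · y) ⊥) ∨_) (trans (∧-comm _ x) (x∧[x·y]≡x∧y x y)) ⟩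
        ((x · y) ⊥) ∨ (x ∧ y)          ≡⟨ x≡[x·y]⊥∨[x∧y] x y ⟨
        x                              ∎
    ; qi-2 = λ x y z → begin
        (x · y) · (x · z)              ≡⟨ [x·y]·[x·z]≡[x∧y]·z x y z ⟩
        (x ∧ y) · z                    ≡⟨ cong (_· z) (∧-comm x y) ⟩
        (y ∧ x) · z                    ≡⟨ [x·y]·[x·z]≡[x∧y]·z y x z ⟨
        (y · x) · (y · z)              ∎
    ; qi-3 = λ x y → begin
        ((x · y) · (y · x)) · x                  ≡⟨ [[x·y]·[y·x]]·x≡[[x·y]∧[y·x]]⊥∨[x∧y] x y ⟩
        (((x · y) ∧ (y · x)) ⊥) ∨ (x ∧ y)        ≡⟨ cong₂ (λ s t → (s ⊥) ∨ t) (∧-comm _ _) (∧-comm x y) ⟩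
        (((y · x) ∧ (x · y)) ⊥) ∨ (y ∧ x)        ≡⟨ [[x·y]·[y·x]]·x≡[[x·y]∧[y·x]]⊥∨[x∧y] y x ⟨
        ((y · x) · (x · y)) · y                  ∎
    }

  x≤y⇒x·y≡𝟘·𝟘 : ∀ {x y} → x ≤ y → x · y ≡ 𝟘 · 𝟘
  x≤y⇒x·y≡𝟘·𝟘 p = trans (x≤y⇒x·y≡𝟙 p) (sym (x≤y⇒x·y≡𝟙 (𝟘-least 𝟘)))

  isBoundedQuasiImplicationAlgebra : IsBoundedQuasiImplicationAlgebra _·_ 𝟘
  isBoundedQuasiImplicationAlgebra = record
    { isQuasiImplicationAlgebra = isQuasiImplicationAlgebra
    ; 𝟘-bottom                  = λ x → x≤y⇒x·y≡𝟘·𝟘 (𝟘-least x)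
    }

theorem4p5 : ∀ {a} {A : Set a} (_∧_ _∨_ : A → A → A) (_⊥ : A → A) (𝟘 𝟙 : A) (∃ : A → A) →
    IsQuantumMonadicAlgebra _∧_ _∨_ _⊥ 𝟘 𝟙 ∃ →
    IsMonadicQuasiImplicationAlgebra (p-s _∧_ _∨_ _⊥) 𝟘 ∃
theorem4p5 _∧_ _∨_ _⊥ 𝟘 𝟙 ∃ Q = record
  { isBoundedQuasiImplicationAlgebra = isBoundedQuasiImplicationAlgebra
  ; ◇-a₁ = λ x → x≤y⇒x·y≡𝟘·𝟘 (≤-reflexive (∃-idem x))
  ; ◇-a₂ = λ x → x≤y⇒x·y≡𝟘·𝟘 (∃-incr x)
  ; ◇-b₁ = λ x → begin
      ∃ (∃ x · 𝟘)          ≡⟨ cong ∃ (x·𝟘≡x⊥ (∃ x)) ⟩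
      ∃ ((∃ x) ⊥)          ≡⟨ ∃-⊥ x ⟩
      (∃ x) ⊥              ≡⟨ x·𝟘≡x⊥ (∃ x) ⟨
      ∃ x · 𝟘              ∎
  ; ◇-b₂ = ∃-𝟘
  ; ◇-c  = λ x y → begin
      ∃ (((x · 𝟘) · (y · 𝟘)) · x)           ≡⟨ cong ∃ ([[x·𝟘]·[y·𝟘]]·x≡x∨y x y) ⟩
      ∃ (x ∨ y)                             ≡⟨ ∃-∨ x y ⟩
      ∃ x ∨ ∃ y                             ≡⟨ [[x·𝟘]·[y·𝟘]]·x≡x∨y (∃ x) (∃ y) ⟨
      ((∃ x · 𝟘) · (∃ y · 𝟘)) · ∃ x         ∎
  }
  where
  open IsQuantumMonadicAlgebra Q
  open OrthomodularLatticeProperties isOrthomodularLattice using (≤-reflexive)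
  open SasakiImplication isOrthomodularLattice
  open ≡-Reasoning
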